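{- Let $f:2^V\to\mathbb{R}$ be non-decreasing, let $p_i\in[0,1]$ for $i\in V$, let $\{n_i\ge1\}_{i\in V}$ be integers and let $(f',V',\{p'_j\})$ be the instance obtained by splitting. Then $\mathcal{L}(f,V,\{p_i\})=\mathcal{L}(f',V',\{p'_j\})$.
   Context: Split operation: each $i\in V$ is replaced by $n_i$ copies $C^i_1,\dots,C^i_{n_i}$, each with marginal probability $p'_{C^i_k}=p_i/n_i$; $V'$ is the set of all copies. For $S'\subseteq V'$ let $\Pi(S')=\{i\in V: C^i_k\in S'\text{ for some }k\}$ and $f'(S')=f(\Pi(S'))$. For a ground set $W$, $h:2^W\to\mathbb{R}$ and marginals $\{q_w\}$, $\mathcal{L}(h,W,\{q_w\})$ is the maximum of $\mathbb{E}_{\mathcal D}[h(S)]$ over all probability distributions $\mathcal D$ on $2^W$ with $\Pr_{\mathcal D}(w\in S)=q_w$ for all $w\in W$. -}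

module Defs where

open import Level using (Level; _⊔_; suc)
open import Data.Nat using (ℕ; zero) renaming (suc to sucℕ)
open import Data.Fin using (Fin) renaming (zero to fzero; suc to fsuc)
open import Data.Bool using (Bool; true; false; _∨_) renaming (T to IsTrue)
open import Data.List using (List; []; _∷_)
open import Data.Product using (Σ; _×_; _,_; ∃; proj₁; proj₂)
open import Data.List.Relation.Unary.All using (All)
open import Algebra.Bundles using (CommutativeRing)
open import Relation.Binary.Structures using (IsTotalOrder)
open import Relation.Nullary using (¬_)

-- A (linearly) ordered field.  The paper works over ℝ; we state the result
-- for an arbitrary ordered field (ℝ being one instance).
record OrderedField (c ℓ : Level) : Set (suc (c ⊔ ℓ)) where
  field
    commutativeRing : CommutativeRing c ℓ
  open CommutativeRing commutativeRing public
  field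
    _≤_          : Carrier → Carrier → Set ℓ
    isTotalOrder : IsTotalOrder _≈_ _≤_
    +-mono-≤     : ∀ {x y} z → x ≤ y → (x + z) ≤ (y + z)
    *-nonneg     : ∀ {x y} → 0# ≤ x → 0# ≤ y → 0# ≤ (x * y)
    nontrivial   : ¬ (1# ≈ 0#)
    _⁻¹          : (x : Carrier) → ¬ (x ≈ 0#) → Carrier
    inverseʳ     : ∀ x (nz : ¬ (x ≈ 0#)) → (x * _⁻¹ x nz) ≈ 1#

module _ {c ℓ : Level} (F : OrderedField c ℓ) where
  open OrderedField F

  fromℕ : ℕ → Carrier
  fromℕ zero = 0#
  fromℕ (sucℕ n) = 1# + fromℕ n

  Subset : Set → Set
  Subset W = W → Bool

  _⊆_ : {W : Set} → Subset W → Subset W → Set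
  S ⊆ U = ∀ w → IsTrue (S w) → IsTrue (U w)

  NonDecreasing : {W : Set} → (Subset W → Carrier) → Set ℓ
  NonDecreasing {W} h = ∀ (S T : Subset W) → S ⊆ T → h S ≤ h T

  -- a finitely supported probability distribution on 2^W, given as a list of
  -- (weight, subset) pairs (repetitions allowed); every distribution on the
  -- finite set 2^W is of this form
  Dist : Set → Set c
  Dist W = List (Carrier × Subset W)

  sumL : List Carrier → Carrier
  sumL [] = 0#
  sumL (x ∷ xs) = x + sumL xs

  totalMass : {W : Set} → Dist W → Carrier
  totalMass [] = 0#
  totalMass ((a , _) ∷ D) = a + totalMass D

  indicator : Bool → Carrier
  indicator true = 1#
  indicator false = 0#

  marginal : {W : Set} → Dist W → W → Carrier
  marginal [] w = 0#
  marginal ((a , S) ∷ D) w = (a * indicator (S w)) + marginal D w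

  expect : {W : Set} → (Subset W → Carrier) → Dist W → Carrier
  expect h [] = 0#
  expect h ((a , S) ∷ D) = (a * h S) + expect h D

  IsProbDist : {W : Set} → Dist W → Set (c ⊔ ℓ)
  IsProbDist D = All (λ aS → 0# ≤ proj₁ aS) D × (totalMass D ≈ 1#)

  Feasible : {W : Set} → (W → Carrier) → Dist W → Set (c ⊔ ℓ)
  Feasible {W} q D = IsProbDist D × (∀ (w : W) → marginal D w ≈ q w)

  -- x = 𝓛(h, W, {q_w}): x is the maximum of E_D[h(S)] over all feasible D
  -- (attained, and an upper bound)
  IsL : {W : Set} → (Subset W → Carrier) → (W → Carrier) → Carrier → Set (c ⊔ ℓ)
  IsL h q x = (∃ λ D → Feasible q D × (expect h D ≈ x))
            × (∀ D → Feasible q D → expect h D ≤ x)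

  anyFin : (k : ℕ) → (Fin k → Bool) → Bool
  anyFin zero g = false
  anyFin (sucℕ k) g = g fzero ∨ anyFin k (λ j → g (fsuc j))

  Copies : (m : ℕ) → (Fin m → ℕ) → Set
  Copies m n = Σ (Fin m) (λ i → Fin (n i))

  Π : {m : ℕ} {n : Fin m → ℕ} → Subset (Copies m n) → Subset (Fin m)
  Π {n = n} S' i = anyFin (n i) (λ k → S' (i , k))

  splitF : {m : ℕ} {n : Fin m → ℕ} → (Subset (Fin m) → Carrier) → Subset (Copies m n) → Carrier
  splitF {m} {n} f S' = f (Π {m} {n} S')

module Submission where

-- Both values are maxima of E_D[·] over feasible distributions, so it suffices
-- that each problem dominates the other (IsL-⇔): every feasible D for one is
-- matched by a feasible D′ for the other with at least the same expectation.
--  * V → V′ (split-dominates): put each i into all its copies, then spread the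
--    mass of every atom evenly over the n i copies of i, one i at a time.
--    f′ does not see which copy is present, so E[f] is unchanged, and the
--    marginal of each copy becomes p i / n i.
--  * V′ → V (merge-dominates): project D′ to V.  E[f′] is unchanged, and by
--    the union bound the marginals are at most p.  Completion then moves mass
--    from sets S ∌ i to S ∪ {i} until the marginal of i is p i; since f is
--    non-decreasing, E[f] does not decrease.

open import Defs
open import Level using (Level; _⊔_)
open import Data.Nat using (ℕ; _≥_) renaming (zero to zeroℕ; suc to sucℕ)
open import Data.Fin using (Fin; _≟_) renaming (zero to fzero; suc to fsuc)
open import Data.Bool using (Bool; true; false; _∨_; _∧_; not; T)
open import Data.Bool.Properties using (∨-identityʳ)
open import Data.List using (List; []; _∷_; _++_; map; tabulate; allFin)
open import Data.List.Membership.Propositional using (_∈_)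
open import Data.List.Membership.Propositional.Properties using (∈-allFin)
open import Data.List.Relation.Unary.Any using (here; there)
open import Data.List.Relation.Unary.All using (All; []; _∷_)
import Data.List.Relation.Unary.All.Properties as All
open import Data.Product using (_×_; _,_; proj₁; proj₂; Σ)
open import Data.Sum using (inj₁; inj₂)
open import Data.Empty using (⊥-elim)
open import Function.Base using (_∘_)
open import Function.Bundles using (_⇔_; mk⇔)
open import Relation.Nullary using (¬_; Dec; yes; no; does)
open import Relation.Nullary.Decidable using (dec-true; dec-false)
open import Relation.Binary.Definitions using (DecidableEquality)
open import Relation.Binary.Bundles using (Poset)
open import Relation.Binary.Structures using (IsTotalOrder)
open import Relation.Binary.PropositionalEquality as ≡ using (_≡_; _≢_)

module _ {c ℓ : Level} (F : OrderedField c ℓ) where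
  open OrderedField F
  module ≤ = IsTotalOrder isTotalOrder
  open import Algebra.Properties.Ring ring using (-‿involutive; -1*x≈-x; -‿distribʳ-*; x[y-z]≈xy-xz)
  open import Algebra.Properties.Group +-group using (//-rightDividesˡ; //-rightDividesʳ)

  poset : Poset c ℓ ℓ
  poset = record { isPartialOrder = ≤.isPartialOrder }
  open import Relation.Binary.Reasoning.PartialOrder poset
  open import Algebra.Properties.Semiring.Sum semiring
    using (sum-syntax; sum-cong-≋; sum-cong-≗; sum-replicate-zero)

  +-monoʳ-≤ : ∀ z {x y} → x ≤ y → (z + x) ≤ (z + y)
  +-monoʳ-≤ z {x} {y} x≤y = begin
    z + x ≈⟨ +-comm z x ⟩
    x + z ≤⟨ +-mono-≤ z x≤y ⟩
    y + z ≈⟨ +-comm y z ⟩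
    z + y ∎

  +-mono : ∀ {x y u v} → x ≤ y → u ≤ v → (x + u) ≤ (y + v)
  +-mono {y = y} {u} x≤y u≤v = ≤.trans (+-mono-≤ u x≤y) (+-monoʳ-≤ y u≤v)

  x≤y⇒0≤y-x : ∀ {x y} → x ≤ y → 0# ≤ (y - x)
  x≤y⇒0≤y-x {x} {y} x≤y = begin
    0#    ≈⟨ -‿inverseʳ x ⟨
    x - x ≤⟨ +-mono-≤ (- x) x≤y ⟩
    y - x ∎

  0≤y-x⇒x≤y : ∀ {x y} → 0# ≤ (y - x) → x ≤ y
  0≤y-x⇒x≤y {x} {y} 0≤y-x = begin
    x             ≈⟨ +-identityˡ x ⟨
    0# + x        ≤⟨ +-mono-≤ x 0≤y-x ⟩
    (y - x) + x   ≈⟨ //-rightDividesˡ x y ⟩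
    y             ∎

  x≤0⇒0≤-x : ∀ {x} → x ≤ 0# → 0# ≤ (- x)
  x≤0⇒0≤-x {x} x≤0 = ≤.trans (x≤y⇒0≤y-x x≤0) (≤.reflexive (+-identityˡ (- x)))

  0≤-x⇒x≤0 : ∀ {x} → 0# ≤ (- x) → x ≤ 0#
  0≤-x⇒x≤0 {x} 0≤-x = 0≤y-x⇒x≤y (≤.trans 0≤-x (≤.reflexive (sym (+-identityˡ (- x)))))

  x≤y+z⇒x-y≤z : ∀ {x y z} → x ≤ (y + z) → (x - y) ≤ z
  x≤y+z⇒x-y≤z {x} {y} {z} x≤y+z = begin
    x - y         ≤⟨ +-mono-≤ (- y) x≤y+z ⟩
    (y + z) - y   ≈⟨ +-congʳ (+-comm y z) ⟩
    (z + y) - y   ≈⟨ //-rightDividesʳ y z ⟩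
    z             ∎

  -- If 1 ≤ 0 then 1 = (-1)(-1) would be a product of non-negatives.
  0≤1 : 0# ≤ 1#
  0≤1 with ≤.total 0# 1#
  ... | inj₁ 0≤1 = 0≤1
  ... | inj₂ 1≤0 = begin
    0#              ≤⟨ *-nonneg 0≤-1 0≤-1 ⟩
    - 1# * - 1#     ≈⟨ -1*x≈-x (- 1#) ⟩
    - (- 1#)        ≈⟨ -‿involutive 1# ⟩
    1#              ∎
    where
    0≤-1 : 0# ≤ (- 1#)
    0≤-1 = x≤0⇒0≤-x 1≤0

  1≰0 : ¬ (1# ≤ 0#)
  1≰0 1≤0 = nontrivial (≤.antisym 1≤0 0≤1)

  *-monoˡ-≤ : ∀ {a x y} → 0# ≤ a → x ≤ y → (a * x) ≤ (a * y)
  *-monoˡ-≤ {a} {x} {y} 0≤a x≤y = 0≤y-x⇒x≤y (begin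
    0#            ≤⟨ *-nonneg 0≤a (x≤y⇒0≤y-x x≤y) ⟩
    a * (y - x)   ≈⟨ x[y-z]≈xy-xz a y x ⟩
    a * y - a * x ∎)

  ⁻¹-nonneg : ∀ x (x≉0 : ¬ (x ≈ 0#)) → 0# ≤ x → 0# ≤ _⁻¹ x x≉0
  ⁻¹-nonneg x x≉0 0≤x with ≤.total 0# (_⁻¹ x x≉0)
  ... | inj₁ 0≤x⁻¹ = 0≤x⁻¹
  ... | inj₂ x⁻¹≤0 = ⊥-elim (1≰0 (0≤-x⇒x≤0 (begin
    0#                ≤⟨ *-nonneg 0≤x (x≤0⇒0≤-x x⁻¹≤0) ⟩
    x * - _⁻¹ x x≉0   ≈⟨ -‿distribʳ-* x (_⁻¹ x x≉0) ⟨
    - (x * _⁻¹ x x≉0) ≈⟨ -‿cong (inverseʳ x x≉0) ⟩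
    - 1#              ∎)))

  fromℕ-nonneg : ∀ N → 0# ≤ fromℕ F N
  fromℕ-nonneg zeroℕ = ≤.refl
  fromℕ-nonneg (sucℕ N) = ≤.trans (≤.reflexive (sym (+-identityʳ 0#))) (+-mono 0≤1 (fromℕ-nonneg N))

  fromℕ-≉0 : ∀ N → N ≥ 1 → ¬ (fromℕ F N ≈ 0#)
  fromℕ-≉0 (sucℕ N) _ 1+N≈0 = 1≰0 (begin
    1#              ≈⟨ +-identityʳ 1# ⟨
    1# + 0#         ≤⟨ +-monoʳ-≤ 1# (fromℕ-nonneg N) ⟩
    1# + fromℕ F N  ≈⟨ 1+N≈0 ⟩
    0#              ∎)

  null-atom : ∀ a r → (a * 0# + r) ≈ r
  null-atom a r = trans (+-congʳ (zeroʳ a)) (+-identityˡ r)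

  -- a ≈ δ + (a - δ), the identity behind splitting an atom of weight a.
  split-weight : ∀ a δ z r → (δ * z + ((a - δ) * z + r)) ≈ (a * z + r)
  split-weight a δ z r = begin-equality
    δ * z + ((a - δ) * z + r)  ≈⟨ +-assoc _ _ _ ⟨
    (δ * z + (a - δ) * z) + r  ≈⟨ +-congʳ (distribʳ z δ (a - δ)) ⟨
    (δ + (a - δ)) * z + r      ≈⟨ +-congʳ (*-congʳ (trans (+-comm δ (a - δ)) (//-rightDividesˡ δ a))) ⟩
    a * z + r                  ∎

  indicator-nonneg : ∀ b → 0# ≤ indicator F b
  indicator-nonneg true  = 0≤1
  indicator-nonneg false = ≤.refl

  indicator-∨ : ∀ b b′ → indicator F (b ∨ b′) ≤ (indicator F b + indicator F b′)
  indicator-∨ true  b′ = ≤.trans (≤.reflexive (sym (+-identityʳ 1#))) (+-monoʳ-≤ 1# (indicator-nonneg b′))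
  indicator-∨ false b′ = ≤.reflexive (sym (+-identityˡ _))

  indicator-anyFin : ∀ N (g : Fin N → Bool) → indicator F (anyFin F N g) ≤ (∑[ k < N ] indicator F (g k))
  indicator-anyFin zeroℕ    g = ≤.refl
  indicator-anyFin (sucℕ N) g =
    ≤.trans (indicator-∨ (g fzero) _) (+-monoʳ-≤ _ (indicator-anyFin N (λ k → g (fsuc k))))

  ∑-const : ∀ N x → (∑[ k < N ] x) ≈ (fromℕ F N * x)
  ∑-const zeroℕ    x = sym (zeroˡ x)
  ∑-const (sucℕ N) x = begin-equality
    x + (∑[ k < N ] x)       ≈⟨ +-cong (sym (*-identityˡ x)) (∑-const N x) ⟩
    1# * x + fromℕ F N * x   ≈⟨ distribʳ x 1# (fromℕ F N) ⟨
    (1# + fromℕ F N) * x     ∎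

  ∑-single : ∀ N (l : Fin N) x b → (∑[ k < N ] (x * indicator F (does (l ≟ k) ∧ b))) ≈ (x * indicator F b)
  ∑-single (sucℕ N) fzero    x b = begin-equality
    x * indicator F b + (∑[ k < N ] (x * 0#))  ≈⟨ +-congˡ (sum-cong-≋ {N} (λ _ → zeroʳ x)) ⟩
    x * indicator F b + (∑[ k < N ] 0#)        ≈⟨ +-congˡ (sum-replicate-zero N) ⟩
    x * indicator F b + 0#                     ≈⟨ +-identityʳ _ ⟩
    x * indicator F b                          ∎
  ∑-single (sucℕ N) (fsuc l) x b = trans (+-cong (zeroʳ x) (∑-single N l x b)) (+-identityˡ _)

  NonnegWeights : {W : Set} → Dist F W → Set (c ⊔ ℓ)
  NonnegWeights D = All (λ aS → 0# ≤ proj₁ aS) D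

  member : {W : Set} → W → Subset F W → Carrier
  member w S = indicator F (S w)

  member-≡ : {W : Set} (w : W) (S : Subset F W) {b : Bool} → S w ≡ b → member w S ≈ indicator F b
  member-≡ w S S[w]≡b = reflexive (≡.cong (indicator F) S[w]≡b)

  marginal≡expect : {W : Set} (D : Dist F W) (w : W) → marginal F D w ≡ expect F (member w) D
  marginal≡expect []            w = ≡.refl
  marginal≡expect ((a , S) ∷ D) w = ≡.cong (a * member w S +_) (marginal≡expect D w)

  totalMass≈expect : {W : Set} (D : Dist F W) → totalMass F D ≈ expect F (λ _ → 1#) D
  totalMass≈expect []            = refl
  totalMass≈expect ((a , S) ∷ D) = +-cong (sym (*-identityʳ a)) (totalMass≈expect D)

  expect-cong : {W : Set} {g g′ : Subset F W → Carrier} → (∀ S → g S ≈ g′ S) →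
                ∀ D → expect F g D ≈ expect F g′ D
  expect-cong g≈g′ []            = refl
  expect-cong g≈g′ ((a , S) ∷ D) = +-cong (*-congˡ (g≈g′ S)) (expect-cong g≈g′ D)

  expect-mono : {W : Set} {g g′ : Subset F W → Carrier} → (∀ S → g S ≤ g′ S) →
                ∀ D → NonnegWeights D → expect F g D ≤ expect F g′ D
  expect-mono g≤g′ []            []         = ≤.refl
  expect-mono g≤g′ ((a , S) ∷ D) (0≤a ∷ 0≤D) = +-mono (*-monoˡ-≤ 0≤a (g≤g′ S)) (expect-mono g≤g′ D 0≤D)

  expect-++ : {W : Set} (g : Subset F W → Carrier) (D E : Dist F W) →
              expect F g (D ++ E) ≈ (expect F g D + expect F g E)
  expect-++ g []            E = sym (+-identityˡ _)
  expect-++ g ((a , S) ∷ D) E = trans (+-congˡ (expect-++ g D E)) (sym (+-assoc _ _ _))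

  expect-+ : {W : Set} (g g′ : Subset F W → Carrier) (D : Dist F W) →
             expect F (λ S → g S + g′ S) D ≈ (expect F g D + expect F g′ D)
  expect-+ g g′ []            = sym (+-identityˡ 0#)
  expect-+ g g′ ((a , S) ∷ D) = begin-equality
    a * (g S + g′ S) + expect F (λ T → g T + g′ T) D
      ≈⟨ +-cong (distribˡ a (g S) (g′ S)) (expect-+ g g′ D) ⟩
    (a * g S + a * g′ S) + (expect F g D + expect F g′ D)
      ≈⟨ +-assoc _ _ _ ⟩
    a * g S + (a * g′ S + (expect F g D + expect F g′ D))
      ≈⟨ +-congˡ (trans (+-comm _ _) (+-assoc _ _ _)) ⟩
    a * g S + (expect F g D + (expect F g′ D + a * g′ S))
      ≈⟨ +-assoc _ _ _ ⟨
    (a * g S + expect F g D) + (expect F g′ D + a * g′ S)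
      ≈⟨ +-congˡ (+-comm _ _) ⟩
    (a * g S + expect F g D) + (a * g′ S + expect F g′ D) ∎

  expect-∑ : {W : Set} (N : ℕ) (g : Fin N → Subset F W → Carrier) (D : Dist F W) →
             expect F (λ S → ∑[ k < N ] g k S) D ≈ (∑[ k < N ] expect F (g k) D)
  expect-∑ zeroℕ    g D = expect-zero D
    where
    expect-zero : ∀ D → expect F (λ _ → 0#) D ≈ 0#
    expect-zero []            = refl
    expect-zero ((a , S) ∷ D) = trans (null-atom a _) (expect-zero D)
  expect-∑ (sucℕ N) g D =
    trans (expect-+ (g fzero) (λ S → ∑[ k < N ] g (fsuc k) S) D) (+-congˡ (expect-∑ N (λ k → g (fsuc k)) D))

  expect-tabulate : {W : Set} (g : Subset F W → Carrier) (N : ℕ) (w : Carrier) (T : Fin N → Subset F W) →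
                    expect F g (tabulate (λ k → w , T k)) ≡ (∑[ k < N ] (w * g (T k)))
  expect-tabulate g zeroℕ    w T = ≡.refl
  expect-tabulate g (sucℕ N) w T = ≡.cong (w * g (T fzero) +_) (expect-tabulate g N w (λ k → T (fsuc k)))

  mapSets : {W U : Set} → (Subset F W → Subset F U) → Dist F W → Dist F U
  mapSets π = map (λ aS → proj₁ aS , π (proj₂ aS))

  expect-mapSets : {W U : Set} (g : Subset F U → Carrier) (π : Subset F W → Subset F U) (D : Dist F W) →
                   expect F g (mapSets π D) ≡ expect F (λ S → g (π S)) D
  expect-mapSets g π []            = ≡.refl
  expect-mapSets g π ((a , S) ∷ D) = ≡.cong (a * g (π S) +_) (expect-mapSets g π D)

  mapSets-nonneg : {W U : Set} (π : Subset F W → Subset F U) (D : Dist F W) →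
                   NonnegWeights D → NonnegWeights (mapSets π D)
  mapSets-nonneg π D = All.map⁺

  nondecreasing-ext : {W : Set} {h : Subset F W → Carrier} → NonDecreasing F h →
                      ∀ {S S′} → (∀ w → S w ≡ S′ w) → h S ≈ h S′
  nondecreasing-ext h-mono {S} {S′} S≗S′ =
    ≤.antisym (h-mono S S′ (λ w → ≡.subst T (S≗S′ w))) (h-mono S′ S (λ w → ≡.subst T (≡.sym (S≗S′ w))))

  Dominated : {W W′ : Set} → (Subset F W → Carrier) → (W → Carrier) →
              (Subset F W′ → Carrier) → (W′ → Carrier) → Set (c ⊔ ℓ)
  Dominated {W} {W′} h q h′ q′ =
    ∀ (D : Dist F W) → Feasible F q D → Σ (Dist F W′) λ D′ → Feasible F q′ D′ × (expect F h D ≤ expect F h′ D′)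

  IsL-transfer : {W W′ : Set} {h : Subset F W → Carrier} {q : W → Carrier}
                 {h′ : Subset F W′ → Carrier} {q′ : W′ → Carrier} →
                 Dominated h q h′ q′ → Dominated h′ q′ h q →
                 ∀ x → IsL F h q x → IsL F h′ q′ x
  IsL-transfer dom dom′ x ((D , feasD , E[D]≈x) , optimal) with dom D feasD
  ... | D′ , feasD′ , E[D]≤E[D′] =
    (D′ , feasD′ , ≤.antisym (optimal′ D′ feasD′) (≤.trans (≤.reflexive (sym E[D]≈x)) E[D]≤E[D′])) , optimal′
    where
    optimal′ : ∀ E → Feasible F _ E → expect F _ E ≤ x
    optimal′ E feasE with dom′ E feasE
    ... | E₀ , feasE₀ , E[E]≤E[E₀] = ≤.trans E[E]≤E[E₀] (optimal E₀ feasE₀)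

  IsL-⇔ : {W W′ : Set} {h : Subset F W → Carrier} {q : W → Carrier}
          {h′ : Subset F W′ → Carrier} {q′ : W′ → Carrier} →
          Dominated h q h′ q′ → Dominated h′ q′ h q →
          ∀ x → IsL F h q x ⇔ IsL F h′ q′ x
  IsL-⇔ dom dom′ x = mk⇔ (IsL-transfer dom dom′ x) (IsL-transfer dom′ dom x)

  -- Over a ground set with decidable equality, a probability
  -- distribution whose marginals lie below targets q ≤ 1 can be completed to
  -- one with marginals exactly q without decreasing E[h] for non-decreasing h:
  -- mass is moved from sets S ∌ i to S ∪ {i} until the marginal of i is q i.

  SubFeasible : {W : Set} → (W → Carrier) → Dist F W → Set (c ⊔ ℓ)
  SubFeasible q D = IsProbDist F D × (∀ w → marginal F D w ≤ q w)

  module Completion {W : Set} (_≟W_ : DecidableEquality W) where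

    insert : W → Subset F W → Subset F W
    insert i S j = does (j ≟W i) ∨ S j

    insert-⊇ : ∀ i S → _⊆_ F S (insert i S)
    insert-⊇ i S j j∈S with does (j ≟W i)
    ... | true  = _
    ... | false = j∈S

    insert-here : ∀ i S → insert i S i ≡ true
    insert-here i S = ≡.cong (_∨ S i) (dec-true (i ≟W i) ≡.refl)

    insert-elsewhere : ∀ i S j → j ≢ i → insert i S j ≡ S j
    insert-elsewhere i S j j≢i = ≡.cong (_∨ S j) (dec-false (j ≟W i) j≢i)

    raise : W → Carrier → Dist F W → Dist F W
    raise i δ [] = []
    raise i δ ((a , S) ∷ D) with S i
    ... | true = (a , S) ∷ raise i δ D
    ... | false with ≤.total a δ
    ...   | inj₁ _ = (a , insert i S) ∷ raise i (δ - a) D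
    ...   | inj₂ _ = (δ , insert i S) ∷ (a - δ , S) ∷ D

    raise-nonneg : ∀ i δ D → 0# ≤ δ → NonnegWeights D → NonnegWeights (raise i δ D)
    raise-nonneg i δ []            0≤δ []          = []
    raise-nonneg i δ ((a , S) ∷ D) 0≤δ (0≤a ∷ 0≤D) with S i
    ... | true = 0≤a ∷ raise-nonneg i δ D 0≤δ 0≤D
    ... | false with ≤.total a δ
    ...   | inj₁ a≤δ = 0≤a ∷ raise-nonneg i (δ - a) D (x≤y⇒0≤y-x a≤δ) 0≤D
    ...   | inj₂ δ≤a = 0≤δ ∷ x≤y⇒0≤y-x δ≤a ∷ 0≤D

    raise-preserves : ∀ i (g : Subset F W → Carrier) → (∀ S → g (insert i S) ≈ g S) →
                      ∀ δ D → expect F g (raise i δ D) ≈ expect F g D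
    raise-preserves i g g-inv δ [] = refl
    raise-preserves i g g-inv δ ((a , S) ∷ D) with S i
    ... | true = +-congˡ (raise-preserves i g g-inv δ D)
    ... | false with ≤.total a δ
    ...   | inj₁ _ = +-cong (*-congˡ (g-inv S)) (raise-preserves i g g-inv (δ - a) D)
    ...   | inj₂ _ = trans (+-congʳ (*-congˡ (g-inv S))) (split-weight a δ (g S) (expect F g D))

    raise-improves : ∀ i (g : Subset F W → Carrier) → (∀ S → g S ≤ g (insert i S)) →
                     ∀ δ D → 0# ≤ δ → NonnegWeights D → expect F g D ≤ expect F g (raise i δ D)
    raise-improves i g g-up δ []            0≤δ []          = ≤.refl
    raise-improves i g g-up δ ((a , S) ∷ D) 0≤δ (0≤a ∷ 0≤D) with S i
    ... | true = +-monoʳ-≤ _ (raise-improves i g g-up δ D 0≤δ 0≤D)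
    ... | false with ≤.total a δ
    ...   | inj₁ a≤δ =
      +-mono (*-monoˡ-≤ 0≤a (g-up S)) (raise-improves i g g-up (δ - a) D (x≤y⇒0≤y-x a≤δ) 0≤D)
    ...   | inj₂ _ = begin
      a * g S + expect F g D                          ≈⟨ split-weight a δ (g S) (expect F g D) ⟨
      δ * g S + ((a - δ) * g S + expect F g D)        ≤⟨ +-mono-≤ _ (*-monoˡ-≤ 0≤δ (g-up S)) ⟩
      δ * g (insert i S) + ((a - δ) * g S + expect F g D) ∎

    weight-on-insert : ∀ (i : W) x (S : Subset F W) → (x * member i (insert i S)) ≈ x
    weight-on-insert i x S = trans (*-congˡ (member-≡ i (insert i S) (insert-here i S))) (*-identityʳ x)

    absent : W → Subset F W → Carrier
    absent i S = indicator F (not (S i))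

    raise-marginal : ∀ i δ D → 0# ≤ δ → δ ≤ expect F (absent i) D →
                     expect F (member i) (raise i δ D) ≈ (expect F (member i) D + δ)
    raise-marginal i δ [] 0≤δ δ≤0 = trans (sym (+-identityʳ 0#)) (+-congˡ (≤.antisym 0≤δ δ≤0))
    raise-marginal i δ ((a , S) ∷ D) 0≤δ δ≤A with S i in S[i]
    ... | true = begin-equality
      a * member i S + expect F (member i) (raise i δ D)
        ≈⟨ +-cong (*-congˡ (member-≡ i S S[i])) (raise-marginal i δ D 0≤δ δ≤A′) ⟩
      a * 1# + (expect F (member i) D + δ)        ≈⟨ +-assoc _ _ _ ⟨
      (a * 1# + expect F (member i) D) + δ        ∎
      where
      δ≤A′ : δ ≤ expect F (absent i) D
      δ≤A′ = ≤.trans δ≤A (≤.reflexive (null-atom a _))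
    ... | false with ≤.total a δ
    ...   | inj₁ a≤δ = begin-equality
      a * member i (insert i S) + expect F (member i) (raise i (δ - a) D)
        ≈⟨ +-cong (weight-on-insert i a S) (raise-marginal i (δ - a) D (x≤y⇒0≤y-x a≤δ) δ-a≤A′) ⟩
      a + (M + (δ - a))    ≈⟨ +-comm a _ ⟩
      (M + (δ - a)) + a    ≈⟨ +-assoc _ _ _ ⟩
      M + ((δ - a) + a)    ≈⟨ +-congˡ (//-rightDividesˡ a δ) ⟩
      M + δ                ≈⟨ +-congʳ (null-atom a M) ⟨
      (a * 0# + M) + δ     ∎
      where
      M = expect F (member i) D
      δ-a≤A′ : (δ - a) ≤ expect F (absent i) D
      δ-a≤A′ = x≤y+z⇒x-y≤z (≤.trans δ≤A (≤.reflexive (+-congʳ (*-identityʳ a))))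
    ...   | inj₂ _ = begin-equality
      δ * member i (insert i S) + ((a - δ) * member i S + M)
        ≈⟨ +-cong (weight-on-insert i δ S) (trans (+-congʳ (*-congˡ (member-≡ i S S[i]))) (null-atom (a - δ) M)) ⟩
      δ + M               ≈⟨ +-comm δ M ⟩
      M + δ               ≈⟨ +-congʳ (null-atom a M) ⟨
      (a * 0# + M) + δ    ∎
      where M = expect F (member i) D

    absent+member : ∀ i S → (absent i S + member i S) ≈ 1#
    absent+member i S with S i
    ... | true  = +-identityˡ 1#
    ... | false = +-identityʳ 1#

    absent-mass : ∀ i D → totalMass F D ≈ 1# → expect F (absent i) D ≈ (1# - expect F (member i) D)
    absent-mass i D mass[D]≈1 = begin-equality
      expect F (absent i) D                          ≈⟨ //-rightDividesʳ M _ ⟨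
      (expect F (absent i) D + M) - M                ≈⟨ +-congʳ (expect-+ (absent i) (member i) D) ⟨
      expect F (λ S → absent i S + member i S) D - M ≈⟨ +-congʳ (expect-cong (absent+member i) D) ⟩
      expect F (λ _ → 1#) D - M                      ≈⟨ +-congʳ (totalMass≈expect D) ⟨
      totalMass F D - M                              ≈⟨ +-congʳ mass[D]≈1 ⟩
      1# - M                                         ∎
      where M = expect F (member i) D

    raise-mass : ∀ i δ D → totalMass F (raise i δ D) ≈ totalMass F D
    raise-mass i δ D = begin-equality
      totalMass F (raise i δ D)          ≈⟨ totalMass≈expect (raise i δ D) ⟩
      expect F (λ _ → 1#) (raise i δ D)  ≈⟨ raise-preserves i (λ _ → 1#) (λ _ → refl) δ D ⟩
      expect F (λ _ → 1#) D              ≈⟨ totalMass≈expect D ⟨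
      totalMass F D                      ∎

    raise-marginal-elsewhere : ∀ i δ D j → j ≢ i → marginal F (raise i δ D) j ≈ marginal F D j
    raise-marginal-elsewhere i δ D j j≢i = begin-equality
      marginal F (raise i δ D) j          ≡⟨ marginal≡expect (raise i δ D) j ⟩
      expect F (member j) (raise i δ D)   ≈⟨ raise-preserves i (member j) j-untouched δ D ⟩
      expect F (member j) D               ≡⟨ marginal≡expect D j ⟨
      marginal F D j                      ∎
      where
      j-untouched : ∀ S → member j (insert i S) ≈ member j S
      j-untouched S = member-≡ j (insert i S) (insert-elsewhere i S j j≢i)

    module _ {h : Subset F W → Carrier} (h-mono : NonDecreasing F h)
             {q : W → Carrier} (q≤1 : ∀ w → q w ≤ 1#) where

      raise-to : ∀ i D → SubFeasible q D →
                 Σ (Dist F W) λ E → SubFeasible q E × (marginal F E i ≈ q i)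
                   × (∀ j → j ≢ i → marginal F E j ≈ marginal F D j) × (expect F h D ≤ expect F h E)
      raise-to i D ((0≤D , mass[D]≈1) , D≤q) =
          E , ((raise-nonneg i δ D 0≤δ 0≤D , trans (raise-mass i δ D) mass[D]≈1) , E≤q)
        , E[i]≈q , raise-marginal-elsewhere i δ D , D≤E
        where
        M = expect F (member i) D
        δ = q i - M
        E = raise i δ D
        0≤δ : 0# ≤ δ
        0≤δ = x≤y⇒0≤y-x (≤.trans (≤.reflexive (reflexive (≡.sym (marginal≡expect D i)))) (D≤q i))
        δ≤absent : δ ≤ expect F (absent i) D
        δ≤absent = ≤.trans (+-mono-≤ (- M) (q≤1 i)) (≤.reflexive (sym (absent-mass i D mass[D]≈1)))
        E[i]≈q : marginal F E i ≈ q i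
        E[i]≈q = begin-equality
          marginal F E i            ≡⟨ marginal≡expect E i ⟩
          expect F (member i) E     ≈⟨ raise-marginal i δ D 0≤δ δ≤absent ⟩
          M + (q i - M)             ≈⟨ +-comm M _ ⟩
          (q i - M) + M             ≈⟨ //-rightDividesˡ M (q i) ⟩
          q i                       ∎
        E≤q : ∀ j → marginal F E j ≤ q j
        E≤q j with j ≟W i
        ... | yes ≡.refl = ≤.reflexive E[i]≈q
        ... | no j≢i     = ≤.trans (≤.reflexive (raise-marginal-elsewhere i δ D j j≢i)) (D≤q j)
        D≤E : expect F h D ≤ expect F h E
        D≤E = raise-improves i h (λ S → h-mono S (insert i S) (insert-⊇ i S)) δ D 0≤δ 0≤D

      complete-on : ∀ (L : List W) D → SubFeasible q D →
                    Σ (Dist F W) λ E → SubFeasible q E × (∀ w → w ∈ L → marginal F E w ≈ q w)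
                      × (expect F h D ≤ expect F h E)
      complete-on []      D subD = D , subD , (λ _ ()) , ≤.refl
      complete-on (i ∷ L) D subD with complete-on L D subD
      ... | E , subE , E≈q-on-L , D≤E with raise-to i E subE
      ...   | E′ , subE′ , E′[i]≈q , E′[j]≈E[j] , E≤E′ = E′ , subE′ , E′≈q , ≤.trans D≤E E≤E′
        where
        E′≈q : ∀ w → w ∈ i ∷ L → marginal F E′ w ≈ q w
        E′≈q w w∈i∷L with w ≟W i
        E′≈q w w∈i∷L         | yes ≡.refl = E′[i]≈q
        E′≈q w (here w≡i)    | no w≢i     = ⊥-elim (w≢i w≡i)
        E′≈q w (there w∈L)   | no w≢i     = trans (E′[j]≈E[j] w w≢i) (E≈q-on-L w w∈L)

      complete : (L : List W) → (∀ w → w ∈ L) → ∀ D → SubFeasible q D →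
                 Σ (Dist F W) λ E → Feasible F q E × (expect F h D ≤ expect F h E)
      complete L enumerates D subD with complete-on L D subD
      ... | E , (probE , _) , E≈q-on-L , D≤E = E , (probE , λ w → E≈q-on-L w (enumerates w)) , D≤E

  anyFin-cong : ∀ N {g g′ : Fin N → Bool} → (∀ k → g k ≡ g′ k) → anyFin F N g ≡ anyFin F N g′
  anyFin-cong zeroℕ    g≗g′ = ≡.refl
  anyFin-cong (sucℕ N) g≗g′ = ≡.cong₂ _∨_ (g≗g′ fzero) (anyFin-cong N (λ k → g≗g′ (fsuc k)))

  anyFin-false : ∀ N → anyFin F N (λ _ → false) ≡ false
  anyFin-false zeroℕ    = ≡.refl
  anyFin-false (sucℕ N) = anyFin-false N

  anyFin-const : ∀ N → N ≥ 1 → ∀ b → anyFin F N (λ _ → b) ≡ b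
  anyFin-const (sucℕ N) _ true  = ≡.refl
  anyFin-const (sucℕ N) _ false = anyFin-false N

  anyFin-single : ∀ N (k : Fin N) b → anyFin F N (λ l → does (l ≟ k) ∧ b) ≡ b
  anyFin-single (sucℕ N) fzero    b = ≡.trans (≡.cong (b ∨_) (anyFin-false N)) (∨-identityʳ b)
  anyFin-single (sucℕ N) (fsuc k) b = anyFin-single N k b

  module Splitting (m : ℕ) (n : Fin m → ℕ) where

    V′ : Set
    V′ = Copies F m n

    project : Subset F V′ → Subset F (Fin m)
    project = Π F {m} {n}

    memberΠ : Fin m → Subset F V′ → Carrier
    memberΠ i T = member i (project T)

    marginal-project≤ : ∀ D′ → NonnegWeights D′ → ∀ i →
                        marginal F (mapSets project D′) i ≤ (∑[ k < n i ] marginal F D′ (i , k))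
    marginal-project≤ D′ 0≤D′ i = begin
      marginal F (mapSets project D′) i                         ≡⟨ marginal≡expect (mapSets project D′) i ⟩
      expect F (member i) (mapSets project D′)                  ≡⟨ expect-mapSets (member i) project D′ ⟩
      expect F (memberΠ i) D′                                   ≤⟨ expect-mono (λ T → indicator-anyFin (n i) (λ k → T (i , k))) D′ 0≤D′ ⟩
      expect F (λ T → ∑[ k < n i ] member (i , k) T) D′         ≈⟨ expect-∑ (n i) (λ k → member (i , k)) D′ ⟩
      (∑[ k < n i ] expect F (member (i , k)) D′)               ≡⟨ ≡.sym (sum-cong-≗ (λ k → marginal≡expect D′ (i , k))) ⟩
      (∑[ k < n i ] marginal F D′ (i , k))                      ∎

    blowUp : Subset F (Fin m) → Subset F V′
    blowUp S c = S (proj₁ c)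

    project-blowUp : (∀ i → n i ≥ 1) → ∀ S i → project (blowUp S) i ≡ S i
    project-blowUp n≥1 S i = anyFin-const (n i) (n≥1 i) (S i)

    shift : (i : Fin m) → Fin (n i) → Subset F V′ → Subset F V′
    shift i k T (j , l) with j ≟ i
    ... | yes ≡.refl = does (l ≟ k) ∧ project T j
    ... | no _       = T (j , l)

    shift-here : ∀ i k T l → shift i k T (i , l) ≡ (does (l ≟ k) ∧ project T i)
    shift-here i k T l with i ≟ i
    ... | yes ≡.refl = ≡.refl
    ... | no i≢i     = ⊥-elim (i≢i ≡.refl)

    shift-elsewhere : ∀ i k T j l → j ≢ i → shift i k T (j , l) ≡ T (j , l)
    shift-elsewhere i k T j l j≢i with j ≟ i
    ... | yes j≡i = ⊥-elim (j≢i j≡i)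
    ... | no _    = ≡.refl

    project-shift : ∀ i k T j → project (shift i k T) j ≡ project T j
    project-shift i k T j = by-cases (j ≟ i)
      where
      -- deciding j ≡ i outside the goal, so that shift-here applies verbatim
      by-cases : Dec (j ≡ i) → project (shift i k T) j ≡ project T j
      by-cases (yes ≡.refl) = ≡.trans (anyFin-cong (n j) (shift-here j k T)) (anyFin-single (n j) k (project T j))
      by-cases (no j≢i)     = anyFin-cong (n j) (λ l → shift-elsewhere i k T j l j≢i)

    module Spreading (ν : Fin m → Carrier) (0≤ν : ∀ i → 0# ≤ ν i)
                     (nν≈1 : ∀ i → (fromℕ F (n i) * ν i) ≈ 1#) where
      open import Algebra.Solver.CommutativeMonoid *-commutativeMonoid using (solve; _⊕_; _⊜_)

      share-weight : ∀ i x z → (fromℕ F (n i) * ((x * ν i) * z)) ≈ (x * z)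
      share-weight i x z = begin-equality
        fromℕ F (n i) * ((x * ν i) * z)  ≈⟨ solve 4 (λ N x v z → N ⊕ ((x ⊕ v) ⊕ z) ⊜ (N ⊕ v) ⊕ (x ⊕ z)) refl (fromℕ F (n i)) x (ν i) z ⟩
        (fromℕ F (n i) * ν i) * (x * z)  ≈⟨ *-congʳ (nν≈1 i) ⟩
        1# * (x * z)                     ≈⟨ *-identityˡ (x * z) ⟩
        x * z                            ∎

      spread : Fin m → Dist F V′ → Dist F V′
      spread i []            = []
      spread i ((a , T) ∷ D) = tabulate (λ k → a * ν i , shift i k T) ++ spread i D

      spread-nonneg : ∀ i D → NonnegWeights D → NonnegWeights (spread i D)
      spread-nonneg i []            []          = []
      spread-nonneg i ((a , T) ∷ D) (0≤a ∷ 0≤D) =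
        All.++⁺ (All.tabulate⁺ (λ k → *-nonneg 0≤a (0≤ν i))) (spread-nonneg i D 0≤D)

      spread-preserves : ∀ i (g : Subset F V′ → Carrier) → (∀ k T → g (shift i k T) ≈ g T) →
                         ∀ D → expect F g (spread i D) ≈ expect F g D
      spread-preserves i g g-inv []            = refl
      spread-preserves i g g-inv ((a , T) ∷ D) = begin-equality
        expect F g (block ++ spread i D)                ≈⟨ expect-++ g block (spread i D) ⟩
        expect F g block + expect F g (spread i D)      ≈⟨ +-cong atom (spread-preserves i g g-inv D) ⟩
        a * g T + expect F g D                          ∎
        where
        block : Dist F V′
        block = tabulate (λ k → a * ν i , shift i k T)
        atom : expect F g block ≈ (a * g T)
        atom = begin-equality
          expect F g block                          ≡⟨ expect-tabulate g (n i) (a * ν i) (λ k → shift i k T) ⟩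
          (∑[ k < n i ] (a * ν i * g (shift i k T)))  ≈⟨ sum-cong-≋ {n i} (λ k → *-congˡ (g-inv k T)) ⟩
          (∑[ k < n i ] (a * ν i * g T))              ≈⟨ ∑-const (n i) _ ⟩
          fromℕ F (n i) * (a * ν i * g T)           ≈⟨ share-weight i a (g T) ⟩
          a * g T                                   ∎

      spread-marginal : ∀ i l D → expect F (member (i , l)) (spread i D) ≈ (ν i * expect F (memberΠ i) D)
      spread-marginal i l []            = sym (zeroʳ (ν i))
      spread-marginal i l ((a , T) ∷ D) = begin-equality
        expect F (member (i , l)) (block ++ spread i D)
          ≈⟨ expect-++ (member (i , l)) block (spread i D) ⟩
        expect F (member (i , l)) block + expect F (member (i , l)) (spread i D)
          ≈⟨ +-cong atom (spread-marginal i l D) ⟩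
        ν i * (a * memberΠ i T) + ν i * expect F (memberΠ i) D
          ≈⟨ distribˡ (ν i) _ _ ⟨
        ν i * (a * memberΠ i T + expect F (memberΠ i) D) ∎
        where
        block : Dist F V′
        block = tabulate (λ k → a * ν i , shift i k T)
        atom : expect F (member (i , l)) block ≈ (ν i * (a * memberΠ i T))
        atom = begin-equality
          expect F (member (i , l)) block
            ≡⟨ expect-tabulate (member (i , l)) (n i) (a * ν i) (λ k → shift i k T) ⟩
          (∑[ k < n i ] (a * ν i * member (i , l) (shift i k T)))
            ≡⟨ sum-cong-≗ (λ k → ≡.cong (λ b → a * ν i * indicator F b) (shift-here i k T l)) ⟩
          (∑[ k < n i ] (a * ν i * indicator F (does (l ≟ k) ∧ project T i)))
            ≈⟨ ∑-single (n i) l (a * ν i) (project T i) ⟩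
          (a * ν i) * memberΠ i T
            ≈⟨ solve 3 (λ a v x → (a ⊕ v) ⊕ x ⊜ v ⊕ (a ⊕ x)) refl a (ν i) (memberΠ i T) ⟩
          ν i * (a * memberΠ i T) ∎

      spreadAll : List (Fin m) → Dist F V′ → Dist F V′
      spreadAll []      D = D
      spreadAll (i ∷ L) D = spread i (spreadAll L D)

      spreadAll-nonneg : ∀ L D → NonnegWeights D → NonnegWeights (spreadAll L D)
      spreadAll-nonneg []      D 0≤D = 0≤D
      spreadAll-nonneg (i ∷ L) D 0≤D = spread-nonneg i (spreadAll L D) (spreadAll-nonneg L D 0≤D)

      spreadAll-preserves : ∀ (g : Subset F V′ → Carrier) → (∀ i k T → g (shift i k T) ≈ g T) →
                            ∀ L D → expect F g (spreadAll L D) ≈ expect F g D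
      spreadAll-preserves g g-inv []      D = refl
      spreadAll-preserves g g-inv (i ∷ L) D =
        trans (spread-preserves i g (g-inv i) (spreadAll L D)) (spreadAll-preserves g g-inv L D)

      memberΠ-shift : ∀ j i k T → memberΠ j (shift i k T) ≈ memberΠ j T
      memberΠ-shift j i k T = reflexive (≡.cong (indicator F) (project-shift i k T j))

      spreadAll-marginal : ∀ L D j l → j ∈ L → marginal F (spreadAll L D) (j , l) ≈ (ν j * expect F (memberΠ j) D)
      spreadAll-marginal (i ∷ L) D j l j∈i∷L with j ≟ i
      spreadAll-marginal (i ∷ L) D j l j∈i∷L | yes ≡.refl = begin-equality
        marginal F (spread j E) (j , l)       ≡⟨ marginal≡expect (spread j E) (j , l) ⟩
        expect F (member (j , l)) (spread j E) ≈⟨ spread-marginal j l E ⟩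
        ν j * expect F (memberΠ j) E           ≈⟨ *-congˡ (spreadAll-preserves (memberΠ j) (memberΠ-shift j) L D) ⟩
        ν j * expect F (memberΠ j) D           ∎
        where E = spreadAll L D
      spreadAll-marginal (i ∷ L) D j l (here j≡i)  | no j≢i = ⊥-elim (j≢i j≡i)
      spreadAll-marginal (i ∷ L) D j l (there j∈L) | no j≢i = begin-equality
        marginal F (spread i E) (j , l)        ≡⟨ marginal≡expect (spread i E) (j , l) ⟩
        expect F (member (j , l)) (spread i E) ≈⟨ spread-preserves i (member (j , l)) copy-j-untouched E ⟩
        expect F (member (j , l)) E            ≡⟨ marginal≡expect E (j , l) ⟨
        marginal F E (j , l)                   ≈⟨ spreadAll-marginal L D j l j∈L ⟩
        ν j * expect F (memberΠ j) D           ∎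
        where
        E = spreadAll L D
        copy-j-untouched : ∀ k T → member (j , l) (shift i k T) ≈ member (j , l) T
        copy-j-untouched k T = reflexive (≡.cong (indicator F) (shift-elsewhere i k T j l j≢i))

  module SplitInstance (m : ℕ) {f : Subset F (Fin m) → Carrier} (f-mono : NonDecreasing F f)
                       {p : Fin m → Carrier} (p≤1 : ∀ i → p i ≤ 1#)
                       (n : Fin m → ℕ) (n≥1 : ∀ i → n i ≥ 1)
                       {p′ : Copies F m n → Carrier} (np′≈p : ∀ i k → (fromℕ F (n i) * p′ (i , k)) ≈ p i) where
    open Splitting m n

    ν : Fin m → Carrier
    ν i = _⁻¹ (fromℕ F (n i)) (fromℕ-≉0 (n i) (n≥1 i))

    nν≈1 : ∀ i → (fromℕ F (n i) * ν i) ≈ 1#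
    nν≈1 i = inverseʳ (fromℕ F (n i)) (fromℕ-≉0 (n i) (n≥1 i))

    open Spreading ν (λ i → ⁻¹-nonneg _ _ (fromℕ-nonneg (n i))) nν≈1

    f′ : Subset F V′ → Carrier
    f′ = splitF F {m} {n} f

    p′≈νp : ∀ i k → p′ (i , k) ≈ (ν i * p i)
    p′≈νp i k = begin-equality
      p′ (i , k)                          ≈⟨ *-identityˡ _ ⟨
      1# * p′ (i , k)                     ≈⟨ *-congʳ (trans (*-comm _ _) (nν≈1 i)) ⟨
      (ν i * fromℕ F (n i)) * p′ (i , k)  ≈⟨ *-assoc _ _ _ ⟩
      ν i * (fromℕ F (n i) * p′ (i , k))  ≈⟨ *-congˡ (np′≈p i k) ⟩
      ν i * p i                           ∎

    split-dominates : Dominated f p f′ p′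
    split-dominates D ((0≤D , mass[D]≈1) , D≈p) = D′ , ((0≤D′ , mass[D′]≈1) , D′≈p′) , E[f]≤E[f′]
      where
      D′ = spreadAll (allFin m) (mapSets blowUp D)
      0≤D′ : NonnegWeights D′
      0≤D′ = spreadAll-nonneg (allFin m) _ (mapSets-nonneg blowUp D 0≤D)
      via-D : ∀ g → (∀ i k T → g (shift i k T) ≈ g T) → expect F g D′ ≈ expect F (λ S → g (blowUp S)) D
      via-D g g-inv = trans (spreadAll-preserves g g-inv (allFin m) _) (reflexive (expect-mapSets g blowUp D))
      mass[D′]≈1 : totalMass F D′ ≈ 1#
      mass[D′]≈1 = begin-equality
        totalMass F D′          ≈⟨ totalMass≈expect D′ ⟩
        expect F (λ _ → 1#) D′  ≈⟨ via-D (λ _ → 1#) (λ _ _ _ → refl) ⟩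
        expect F (λ _ → 1#) D   ≈⟨ totalMass≈expect D ⟨
        totalMass F D           ≈⟨ mass[D]≈1 ⟩
        1#                      ∎
      D′≈p′ : ∀ c → marginal F D′ c ≈ p′ c
      D′≈p′ (j , l) = begin-equality
        marginal F D′ (j , l)                         ≈⟨ spreadAll-marginal (allFin m) _ j l (∈-allFin j) ⟩
        ν j * expect F (memberΠ j) (mapSets blowUp D) ≡⟨ ≡.cong (ν j *_) (expect-mapSets (memberΠ j) blowUp D) ⟩
        ν j * expect F (λ S → memberΠ j (blowUp S)) D ≈⟨ *-congˡ (expect-cong (λ S → reflexive (≡.cong (indicator F) (project-blowUp n≥1 S j))) D) ⟩
        ν j * expect F (member j) D                   ≡⟨ ≡.cong (ν j *_) (marginal≡expect D j) ⟨
        ν j * marginal F D j                          ≈⟨ *-congˡ (D≈p j) ⟩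
        ν j * p j                                     ≈⟨ p′≈νp j l ⟨
        p′ (j , l)                                    ∎
      E[f]≤E[f′] : expect F f D ≤ expect F f′ D′
      E[f]≤E[f′] = ≤.reflexive (sym (begin-equality
        expect F f′ D′                  ≈⟨ via-D f′ (λ i k T → nondecreasing-ext f-mono (project-shift i k T)) ⟩
        expect F (λ S → f′ (blowUp S)) D ≈⟨ expect-cong (λ S → nondecreasing-ext f-mono (project-blowUp n≥1 S)) D ⟩
        expect F f D                    ∎))

    project-subfeasible : ∀ D′ → Feasible F p′ D′ → SubFeasible p (mapSets project D′)
    project-subfeasible D′ ((0≤D′ , mass[D′]≈1) , D′≈p′) = (mapSets-nonneg project D′ 0≤D′ , mass[D₁]≈1) , D₁≤p
      where
      D₁ = mapSets project D′
      mass[D₁]≈1 : totalMass F D₁ ≈ 1#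
      mass[D₁]≈1 = begin-equality
        totalMass F D₁          ≈⟨ totalMass≈expect D₁ ⟩
        expect F (λ _ → 1#) D₁  ≡⟨ expect-mapSets (λ _ → 1#) project D′ ⟩
        expect F (λ _ → 1#) D′  ≈⟨ totalMass≈expect D′ ⟨
        totalMass F D′          ≈⟨ mass[D′]≈1 ⟩
        1#                      ∎
      D₁≤p : ∀ i → marginal F D₁ i ≤ p i
      D₁≤p i = begin
        marginal F D₁ i                          ≤⟨ marginal-project≤ D′ 0≤D′ i ⟩
        (∑[ k < n i ] marginal F D′ (i , k))     ≈⟨ sum-cong-≋ {n i} (λ k → trans (D′≈p′ (i , k)) (p′≈νp i k)) ⟩
        (∑[ k < n i ] (ν i * p i))               ≈⟨ ∑-const (n i) (ν i * p i) ⟩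
        fromℕ F (n i) * (ν i * p i)              ≈⟨ *-assoc _ _ _ ⟨
        (fromℕ F (n i) * ν i) * p i              ≈⟨ *-congʳ (nν≈1 i) ⟩
        1# * p i                                 ≈⟨ *-identityˡ (p i) ⟩
        p i                                      ∎

    merge-dominates : Dominated f′ p′ f p
    merge-dominates D′ feasD′
      with Completion.complete _≟_ f-mono p≤1 (allFin m) ∈-allFin (mapSets project D′) (project-subfeasible D′ feasD′)
    ... | E , feasE , E[f]≤ = E , feasE , ≤.trans (≤.reflexive (reflexive (≡.sym (expect-mapSets f project D′)))) E[f]≤

mainTheorem8 : {c ℓ : Level} (F : OrderedField c ℓ) →
    let open OrderedField F in
    (m : ℕ) (f : Subset F (Fin m) → Carrier) → NonDecreasing F f →
    (p : Fin m → Carrier) → (∀ i → (0# ≤ p i) × (p i ≤ 1#)) →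
    (n : Fin m → ℕ) → (∀ i → n i ≥ 1) →
    (p' : Copies F m n → Carrier) →
    (∀ i k → (fromℕ F (n i) * p' (i , k)) ≈ p i) →
    (x : Carrier) →
    IsL F f p x ⇔ IsL F (splitF F {m} {n} f) p' x
mainTheorem8 F m f f-mono p p∈[0,1] n n≥1 p' np'≈p =
  IsL-⇔ F (split-dominates m f-mono p≤1 n n≥1 np'≈p) (merge-dominates m f-mono p≤1 n n≥1 np'≈p)
  where
  open SplitInstance F
  open OrderedField F using (_≤_; 1#)
  p≤1 : ∀ i → p i ≤ 1#
  p≤1 = proj₂ ∘ p∈[0,1]
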